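{- Every $\mathfrak{m}$-dioid is entire: if $(M,+,\times)$ is an $\mathfrak{m}$-dioid, then there are no nonzero $z, b \in M$ with $b \times z = 0$.
   Context: A semiring is a triple $(S,+,\times)$ in which $(S,+)$ is a commutative monoid with identity $0$, $(S,\times)$ is a monoid with identity $1$, multiplication distributes over addition on both sides, and $a\times 0 = 0 \times a = 0$ for all $a$. It is commutative if $\times$ is commutative. For a commutative monoid $(S,+)$, the canonical preorder is: $a \le b$ iff $a + c = b$ for some $c \in S$. A dioid is a semiring whose additive monoid is canonically ordered, i.e. this canonical preorder is a partial order. An $\mathfrak{m}$-dioid is a commutative dioid $(S,+,\times)$ having an element $\mathfrak{m} \neq 0$ such that $a \times \mathfrak{m} = \mathfrak{m}$ for every nonzero $a \in S$. -}

module Defs where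

open import Level using (_⊔_)
open import Algebra.Bundles using (CommutativeSemiring)
open import Data.Product using (Σ; ∃; _×_)
open import Relation.Nullary using (¬_)

module _ {c ℓ} (S : CommutativeSemiring c ℓ) where
  open CommutativeSemiring S

  CanonicalLeq : Carrier → Carrier → Set (c ⊔ ℓ)
  CanonicalLeq a b = ∃ λ d → (a + d) ≈ b

  -- canonically ordered: the canonical preorder is a partial order
  -- (it is always reflexive and transitive; so this is antisymmetry w.r.t. ≈)
  IsCanonicallyOrdered : Set (c ⊔ ℓ)
  IsCanonicallyOrdered = ∀ a b → CanonicalLeq a b → CanonicalLeq b a → a ≈ b

  IsDioid : Set (c ⊔ ℓ)
  IsDioid = IsCanonicallyOrdered

  IsMDioid : Set (c ⊔ ℓ)
  IsMDioid = IsDioid × (∃ λ m → (¬ (m ≈ 0#)) × (∀ a → ¬ (a ≈ 0#) → (a * m) ≈ m))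

  IsEntire : Set (c ⊔ ℓ)
  IsEntire = ¬ (∃ λ z → ∃ λ b → (¬ (z ≈ 0#)) × (¬ (b ≈ 0#)) × ((b * z) ≈ 0#))

{-# OPTIONS --safe #-}
module Submission where

open import Defs
open import Algebra.Bundles using (Semiring; CommutativeSemiring)
open import Data.Product using (_,_)
import Relation.Binary.Reasoning.Setoid as SetoidReasoning

module _ {c ℓ} (S : Semiring c ℓ) where
  open Semiring S
  open SetoidReasoning setoid

  *-fixedˡ-by-zero-product⇒≈0 : ∀ {m b z} →
    b * m ≈ m → z * m ≈ m → b * z ≈ 0# → m ≈ 0#
  *-fixedˡ-by-zero-product⇒≈0 {m} {b} {z} bm≈m zm≈m bz≈0 = begin
    m            ≈⟨ sym bm≈m ⟩
    b * m        ≈⟨ *-congˡ (sym zm≈m) ⟩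
    b * (z * m)  ≈⟨ sym (*-assoc b z m) ⟩
    (b * z) * m  ≈⟨ *-congʳ bz≈0 ⟩
    0# * m       ≈⟨ zeroˡ m ⟩
    0#           ∎

lemma2p16 : ∀ {c ℓ} (M : CommutativeSemiring c ℓ) → IsMDioid M → IsEntire M
lemma2p16 M (_ , m , m≉0 , absorb) (z , b , z≉0 , b≉0 , bz≈0) =
  m≉0 (*-fixedˡ-by-zero-product⇒≈0 semiring (absorb b b≉0) (absorb z z≉0) bz≈0)
  where open CommutativeSemiring M using (semiring)
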